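{- If $X\in E(\mathcal{S}_n)$, then $|X|\ge n$.
   Context: $\mathcal{S}_n$ is the set of nonzero tuples in $\{ -1,0,1\}^n$ whose first nonzero entry is $1$. A tuple $t\in\{1,0,-1,u\}^n$ eliminates $s\in\mathcal{S}_n$ if: (i) $t_i\neq0$ and $s_i\ne0$ for some $i$; (ii) there is $k\in\{+1,-1\}$ with $t_i=ks_i$ for all $i$ with $s_i\ne0$ and $t_i\ne0$; (iii) $s_i=0$ whenever $t_i=u$. For $X\subseteq\mathcal{S}_n$, $\mathcal{E}(X)$ is the set of elements of $\mathcal{S}_n$ eliminated by some element of $X$, and $E(\mathcal{S}_n)=\{X\subseteq\mathcal{S}_n:\mathcal{E}(X)=\mathcal{S}_n\}$. -}

module Defs where

open import Data.Nat using (ℕ)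
open import Data.Fin using (Fin)
open import Data.Vec using (Vec; []; _∷_; lookup)
open import Data.Product using (Σ; ∃; _×_; _,_)
open import Data.Sum using (_⊎_)
open import Data.Empty using (⊥)
open import Data.Unit using (⊤)
open import Data.List using (List)
open import Data.List.Membership.Propositional using (_∈_)
open import Data.List.Relation.Unary.Unique.Propositional using (Unique)
open import Relation.Binary.PropositionalEquality using (_≡_)
open import Relation.Nullary using (¬_)

data Trit : Set where
  neg zer pos : Trit

data Sym : Set where
  neg zer pos u : Sym

embed : Trit → Sym
embed neg = neg
embed zer = zer
embed pos = pos

data Sign : Set where
  plus minus : Sign

_·_ : Sign → Trit → Sym
plus · s = embed s
minus · neg = pos
minus · zer = zer
minus · pos = neg

FirstNonzeroIsOne : ∀ {n} → Vec Trit n → Set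
FirstNonzeroIsOne [] = ⊥
FirstNonzeroIsOne (neg ∷ v) = ⊥
FirstNonzeroIsOne (zer ∷ v) = FirstNonzeroIsOne v
FirstNonzeroIsOne (pos ∷ v) = ⊤

InS : (n : ℕ) → Vec Trit n → Set
InS n s = FirstNonzeroIsOne s

Eliminates : ∀ {n} → Vec Sym n → Vec Trit n → Set
Eliminates {n} t s =
  (Σ (Fin n) λ i → ¬ lookup t i ≡ zer × ¬ lookup s i ≡ zer)
  × (Σ Sign λ k → (i : Fin n) → ¬ lookup s i ≡ zer → ¬ lookup t i ≡ zer →
        lookup t i ≡ k · lookup s i)
  × ((i : Fin n) → lookup t i ≡ u → lookup s i ≡ zer)

InE : (n : ℕ) → List (Vec Trit n) → Set
InE n X =
  Unique X
  × (∀ {x} → x ∈ X → InS n x)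
  × (∀ s → InS n s → Σ (Vec Trit n) λ x → x ∈ X × Eliminates (Data.Vec.map embed x) s)

-- If |X| < n, the |X| homogeneous linear equations x ∙ v = 0 (x ∈ X) in n integer unknowns
-- have a nonzero solution v, which after a global sign change has its first nonzero entry
-- positive, so the sign pattern of v lies in S_n. If x ∈ X eliminated that pattern with sign
-- k, every term k xᵢ vᵢ of k (x ∙ v) would be nonnegative, and the one at the coordinate
-- where both are nonzero positive, contradicting x ∙ v = 0.
module Submission where

open import Defs
open import Data.Nat using (ℕ; _≤_)
open import Data.Vec using (Vec)
open import Data.List using (List; length)

open import Data.Nat using (zero; suc; _<_; s≤s⁻¹; z<s)
open import Data.Nat.Properties using (≮⇒≥)
open import Data.Integer
  using (ℤ; +_; +[1+_]; -[1+_]; 0ℤ; 1ℤ; -1ℤ; _*_; _+_; _-_; -_; +<+)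
  renaming (_≤_ to _≤ℤ_; _<_ to _<ℤ_)
open import Data.Integer.Properties
  using (_≟_; ≤-reflexive; *-zeroʳ; *-distribˡ-+; +-mono-≤; +-mono-<-≤; +-mono-≤-<; <⇒≤; <-irrefl; i*j≡0⇒i≡0∨j≡0)
open import Data.Integer.Tactic.RingSolver using (solve-∀)
open import Data.Fin using (Fin; zero; suc)
open import Data.Vec using ([]; _∷_; head; tail; map; zipWith; replicate; lookup)
open import Data.Vec.Relation.Unary.Any using (Any; here; there)
open import Data.List using ([]; _∷_)
import Data.List as List
open import Data.List.Relation.Unary.All as All using (All; []; _∷_)
open import Data.List.Relation.Unary.All.Properties using () renaming (map⁻ to All-map⁻)
open import Data.List.Relation.Binary.Permutation.Propositional using (_↭_; ↭-refl; ↭-sym; ↭-trans; prep; swap)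
open import Data.List.Relation.Binary.Permutation.Propositional.Properties using (↭-length; All-resp-↭)
open import Data.List.Properties using (length-map)
open import Data.Product using (∃; ∃₂; _×_; _,_)
open import Data.Sum using (_⊎_; inj₁; inj₂; [_,_]′)
open import Data.Empty using (⊥-elim)
open import Data.Unit using (tt)
open import Function using (_∘_)
open import Relation.Nullary using (¬_; yes; no)
open import Relation.Unary using (Pred; Decidable)
open import Relation.Binary.PropositionalEquality using (_≡_; _≢_; refl; sym; trans; cong; subst; module ≡-Reasoning)

private variable
  n : ℕ

all-or-pivot : ∀ {a p} {A : Set a} {P : Pred A p} → Decidable P → (xs : List A) →
               All P xs ⊎ ∃₂ λ x rest → ¬ P x × xs ↭ x ∷ rest
all-or-pivot P? [] = inj₁ []
all-or-pivot P? (x ∷ xs) with P? x | all-or-pivot P? xs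
... | no ¬px | _                        = inj₂ (x , xs , ¬px , ↭-refl)
... | yes px | inj₁ all                 = inj₁ (px ∷ all)
... | yes px | inj₂ (y , rest , ¬py , σ) = inj₂ (y , x ∷ rest , ¬py , ↭-trans (prep x σ) (swap x y ↭-refl))

infix 7 _∙_
infix 4 _⟂_

_∙_ : Vec ℤ n → Vec ℤ n → ℤ
[]      ∙ []      = 0ℤ
(a ∷ x) ∙ (b ∷ y) = a * b + x ∙ y

_⟂_ : Vec ℤ n → Vec ℤ n → Set
x ⟂ y = x ∙ y ≡ 0ℤ

NonZeroVec : Vec ℤ n → Set
NonZeroVec = Any (_≢ 0ℤ)

∙-zeroʳ : (x : Vec ℤ n) → x ∙ replicate n 0ℤ ≡ 0ℤ
∙-zeroʳ []      = refl
∙-zeroʳ (a ∷ x) rewrite ∙-zeroʳ x | *-zeroʳ a = refl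

∙-scaleʳ : ∀ c (x y : Vec ℤ n) → x ∙ map (c *_) y ≡ c * (x ∙ y)
∙-scaleʳ c []      []      = sym (*-zeroʳ c)
∙-scaleʳ c (a ∷ x) (b ∷ y) rewrite ∙-scaleʳ c x y = lemma a b c (x ∙ y)
  where
  lemma : ∀ a b c d → a * (c * b) + c * d ≡ c * (a * b + d)
  lemma = solve-∀

∙-linearˡ : ∀ c d (x y z : Vec ℤ n) →
            zipWith (λ a b → c * a - d * b) x y ∙ z ≡ c * (x ∙ z) - d * (y ∙ z)
∙-linearˡ c d []      []      []      = lemma c d
  where
  lemma : ∀ c d → 0ℤ ≡ c * 0ℤ - d * 0ℤ
  lemma = solve-∀
∙-linearˡ c d (a ∷ x) (b ∷ y) (e ∷ z) rewrite ∙-linearˡ c d x y z = lemma c d a b e (x ∙ z) (y ∙ z)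
  where
  lemma : ∀ c d a b e X Y → (c * a - d * b) * e + (c * X - d * Y) ≡ c * (a * e + X) - d * (b * e + Y)
  lemma = solve-∀

scale-nonZero : ∀ {c} {x : Vec ℤ n} → c ≢ 0ℤ → NonZeroVec x → NonZeroVec (map (c *_) x)
scale-nonZero {c = c} c≢0 (here b≢0) = here ([ c≢0 , b≢0 ]′ ∘ i*j≡0⇒i≡0∨j≡0 c)
scale-nonZero c≢0 (there nz) = there (scale-nonZero c≢0 nz)

clearHead : ℤ → Vec ℤ n → Vec ℤ (suc n) → Vec ℤ n
clearHead a₀ a' b = zipWith (λ p q → a₀ * p - head b * q) (tail b) a'

-- Gaussian elimination: pivot on a row with nonzero first entry a₀, clear the first entry
-- of every other row b by b ↦ a₀ b' − b₀ a', solve the reduced system in one unknown fewer,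
-- and recover the first unknown from the pivot row.
nonZero-kernel : ∀ n (A : List (Vec ℤ n)) → length A < n → ∃ λ v → NonZeroVec v × All (_⟂ v) A
nonZero-kernel zero A ()
nonZero-kernel (suc n) A |A|<1+n with all-or-pivot (λ a → head a ≟ 0ℤ) A
... | inj₁ heads≡0 = 1ℤ ∷ replicate n 0ℤ , here (λ ()) , All.map (λ {a} → orthogonal {a}) heads≡0
  where
  orthogonal : ∀ {a} → head a ≡ 0ℤ → a ⟂ 1ℤ ∷ replicate n 0ℤ
  orthogonal {_ ∷ a'} refl rewrite ∙-zeroʳ a' = refl
... | inj₂ (a₀ ∷ a' , rest , a₀≢0 , A↭) with nonZero-kernel n (List.map (clearHead a₀ a') rest) |reduced|<n
  where
  |reduced|<n : length (List.map (clearHead a₀ a') rest) < n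
  |reduced|<n rewrite length-map (clearHead a₀ a') rest = subst (_≤ n) (↭-length A↭) (s≤s⁻¹ |A|<1+n)
... | w , w≢0 , w⟂reduced =
  v , there (scale-nonZero a₀≢0 w≢0) ,
  All-resp-↭ (↭-sym A↭) (pivot⟂v ∷ All.map (λ {b} → row⟂v {b}) (All-map⁻ w⟂reduced))
  where
  open ≡-Reasoning
  v : Vec ℤ (suc n)
  v = - (a' ∙ w) ∷ map (a₀ *_) w
  pivot⟂v : a₀ ∷ a' ⟂ v
  pivot⟂v = begin
    a₀ * - (a' ∙ w) + a' ∙ map (a₀ *_) w ≡⟨ cong (_+_ (a₀ * - (a' ∙ w))) (∙-scaleʳ a₀ a' w) ⟩
    a₀ * - (a' ∙ w) + a₀ * (a' ∙ w)     ≡⟨ lemma a₀ (a' ∙ w) ⟩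
    0ℤ                                  ∎
    where
    lemma : ∀ a d → a * - d + a * d ≡ 0ℤ
    lemma = solve-∀
  row⟂v : ∀ {b} → clearHead a₀ a' b ⟂ w → b ⟂ v
  row⟂v {b₀ ∷ b'} reduced⟂w = begin
    b₀ * - (a' ∙ w) + b' ∙ map (a₀ *_) w ≡⟨ cong (_+_ (b₀ * - (a' ∙ w))) (∙-scaleʳ a₀ b' w) ⟩
    b₀ * - (a' ∙ w) + a₀ * (b' ∙ w)     ≡⟨ lemma a₀ b₀ (b' ∙ w) (a' ∙ w) ⟩
    a₀ * (b' ∙ w) - b₀ * (a' ∙ w)       ≡⟨ ∙-linearˡ a₀ b₀ b' a' w ⟨
    zipWith (λ p q → a₀ * p - b₀ * q) b' a' ∙ w ≡⟨ reduced⟂w ⟩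
    0ℤ                                  ∎
    where
    lemma : ∀ a b B D → b * - D + a * B ≡ a * B - b * D
    lemma = solve-∀

trit : ℤ → Trit
trit (+ zero)  = zer
trit +[1+ _ ]  = pos
trit -[1+ _ ]  = neg

tritℤ : Trit → ℤ
tritℤ neg = -1ℤ
tritℤ zer = 0ℤ
tritℤ pos = 1ℤ

signℤ : Sign → ℤ
signℤ plus  = 1ℤ
signℤ minus = -1ℤ

signPattern : Vec ℤ n → Vec Trit n
signPattern = map trit

signPattern-inS⊎negate-inS : {v : Vec ℤ n} → NonZeroVec v →
                             InS n (signPattern v) ⊎ InS n (signPattern (map (-1ℤ *_) v))
signPattern-inS⊎negate-inS {v = + zero ∷ _}   (here 0≢0) = ⊥-elim (0≢0 refl)
signPattern-inS⊎negate-inS {v = + zero ∷ _}   (there nz) = signPattern-inS⊎negate-inS nz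
signPattern-inS⊎negate-inS {v = +[1+ _ ] ∷ _} _          = inj₁ tt
signPattern-inS⊎negate-inS {v = -[1+ _ ] ∷ _} _          = inj₂ tt

sign-normalisation : {v : Vec ℤ n} → NonZeroVec v →
                     ∃ λ w → InS n (signPattern w) × (∀ x → x ⟂ v → x ⟂ w)
sign-normalisation {v = v} nz with signPattern-inS⊎negate-inS nz
... | inj₁ inS = v , inS , λ _ x⟂v → x⟂v
... | inj₂ inS = map (-1ℤ *_) v , inS , λ x x⟂v → trans (∙-scaleʳ -1ℤ x v) (cong (-1ℤ *_) x⟂v)

product-pos : ∀ t a k → embed t ≡ k · trit a → embed t ≢ zer → trit a ≢ zer →
              0ℤ <ℤ signℤ k * (tritℤ t * a)
product-pos zer      _         _     _  t≢0 _   = ⊥-elim (t≢0 refl)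
product-pos _        (+ zero)  _     _  _   a≢0 = ⊥-elim (a≢0 refl)
product-pos pos      +[1+ _ ]  plus  _  _   _   = +<+ z<s
product-pos pos      -[1+ _ ]  minus _  _   _   = +<+ z<s
product-pos neg      +[1+ _ ]  minus _  _   _   = +<+ z<s
product-pos neg      -[1+ _ ]  plus  _  _   _   = +<+ z<s
product-pos pos      +[1+ _ ]  minus ()
product-pos pos      -[1+ _ ]  plus  ()
product-pos neg      +[1+ _ ]  plus  ()
product-pos neg      -[1+ _ ]  minus ()

product-nonneg : ∀ t a k → (trit a ≢ zer → embed t ≢ zer → embed t ≡ k · trit a) →
                 0ℤ ≤ℤ signℤ k * (tritℤ t * a)
product-nonneg zer a            k _     = ≤-reflexive (sym (*-zeroʳ (signℤ k)))
product-nonneg pos (+ zero)     k _     = ≤-reflexive (sym (*-zeroʳ (signℤ k)))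
product-nonneg neg (+ zero)     k _     = ≤-reflexive (sym (*-zeroʳ (signℤ k)))
product-nonneg pos a@(+[1+ _ ]) k agree = <⇒≤ (product-pos pos a k (agree (λ ()) (λ ())) (λ ()) (λ ()))
product-nonneg pos a@(-[1+ _ ]) k agree = <⇒≤ (product-pos pos a k (agree (λ ()) (λ ())) (λ ()) (λ ()))
product-nonneg neg a@(+[1+ _ ]) k agree = <⇒≤ (product-pos neg a k (agree (λ ()) (λ ())) (λ ()) (λ ()))
product-nonneg neg a@(-[1+ _ ]) k agree = <⇒≤ (product-pos neg a k (agree (λ ()) (λ ())) (λ ()) (λ ()))

SignAgreement : Vec Trit n → Vec ℤ n → Sign → Set
SignAgreement {n} x v k = (i : Fin n) → lookup (signPattern v) i ≢ zer → lookup (map embed x) i ≢ zer →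
                          lookup (map embed x) i ≡ k · lookup (signPattern v) i

signed-dot-nonneg : ∀ (x : Vec Trit n) v k → SignAgreement x v k → 0ℤ ≤ℤ signℤ k * (map tritℤ x ∙ v)
signed-dot-nonneg []      []      k _     = ≤-reflexive (sym (*-zeroʳ (signℤ k)))
signed-dot-nonneg (t ∷ x) (a ∷ v) k agree
  rewrite *-distribˡ-+ (signℤ k) (tritℤ t * a) (map tritℤ x ∙ v) =
  +-mono-≤ (product-nonneg t a k (agree zero)) (signed-dot-nonneg x v k (agree ∘ suc))

signed-dot-pos : ∀ (x : Vec Trit n) v k → SignAgreement x v k → ∀ i →
                 lookup (map embed x) i ≢ zer → lookup (signPattern v) i ≢ zer →
                 0ℤ <ℤ signℤ k * (map tritℤ x ∙ v)
signed-dot-pos (t ∷ x) (a ∷ v) k agree i t≢0 a≢0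
  rewrite *-distribˡ-+ (signℤ k) (tritℤ t * a) (map tritℤ x ∙ v) with i
... | zero  = +-mono-<-≤ (product-pos t a k (agree zero a≢0 t≢0) t≢0 a≢0)
                         (signed-dot-nonneg x v k (agree ∘ suc))
... | suc j = +-mono-≤-< (product-nonneg t a k (agree zero))
                         (signed-dot-pos x v k (agree ∘ suc) j t≢0 a≢0)

orthogonal⇒¬eliminates : ∀ (x : Vec Trit n) v → map tritℤ x ⟂ v → ¬ Eliminates (map embed x) (signPattern v)
orthogonal⇒¬eliminates x v x⟂v ((i , t≢0 , a≢0) , (k , agree) , _) =
  <-irrefl (sym signed-dot≡0) (signed-dot-pos x v k agree i t≢0 a≢0)
  where
  signed-dot≡0 : signℤ k * (map tritℤ x ∙ v) ≡ 0ℤ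
  signed-dot≡0 = trans (cong (signℤ k *_) x⟂v) (*-zeroʳ (signℤ k))

mainTheorem5 : (n : ℕ) (X : List (Vec Trit n)) → InE n X → n ≤ length X
mainTheorem5 n X (_ , _ , covers) = ≮⇒≥ λ |X|<n →
  let |A|<n = subst (_< n) (sym (length-map (map tritℤ) X)) |X|<n
      (v , v≢0 , A⟂v) = nonZero-kernel n (List.map (map tritℤ) X) |A|<n
      (w , w-inS , ⟂v⇒⟂w) = sign-normalisation v≢0
      (x , x∈X , x-eliminates) = covers (signPattern w) w-inS
  in orthogonal⇒¬eliminates x w (⟂v⇒⟂w (map tritℤ x) (All.lookup (All-map⁻ A⟂v) x∈X)) x-eliminates
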